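{- If $G$ is a graph with $\Delta(G)\ge6$, then $\mu_{\mathrm{int}}(G)\le\left\lceil\frac{\Delta(G)}{2}\right\rceil$.
   Context: Graphs are finite and simple; $\Delta(G)$ is the maximum degree. A $k$-improper edge coloring of $G$ is a map $\alpha:E(G)\to\mathbb{N}$ such that at most $k$ edges with a common endpoint receive the same color; it is an improper interval coloring if at every vertex the colors on incident edges form a set of consecutive integers. $\mu_{\mathrm{int}}(G)$ is the smallest $k$ such that $G$ has a $k$-improper interval edge coloring. -}

module Defs where

open import Data.Nat using (ℕ; zero; suc; _+_; _≤_; _⊔_; _≡ᵇ_)
open import Data.Bool using (Bool; true; false; if_then_else_; _∧_)
open import Data.Fin using (Fin; zero; suc)
open import Data.Product using (Σ; _×_; ∃; ∃-syntax; _,_)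
open import Relation.Binary.PropositionalEquality using (_≡_)

record Graph (n : ℕ) : Set where
  field
    adj    : Fin n → Fin n → Bool
    sym    : ∀ u v → adj u v ≡ adj v u
    irrefl : ∀ u → adj u u ≡ false
open Graph public

count : ∀ {n} → (Fin n → Bool) → ℕ
count {zero}  P = 0
count {suc n} P = (if P zero then 1 else 0) + count (λ i → P (suc i))

maxFin : ∀ {n} → (Fin n → ℕ) → ℕ
maxFin {zero}  f = 0
maxFin {suc n} f = f zero ⊔ maxFin (λ i → f (suc i))

degree : ∀ {n} → Graph n → Fin n → ℕ
degree G u = count (adj G u)

Δ : ∀ {n} → Graph n → ℕ
Δ G = maxFin (degree G)

-- An edge coloring: a symmetric map assigning a colour α u v to each
-- pair; only its values on edges (adj u v ≡ true) are relevant.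
record EdgeColoring {n : ℕ} (G : Graph n) : Set where
  field
    col     : Fin n → Fin n → ℕ
    col-sym : ∀ u v → col u v ≡ col v u
open EdgeColoring public

IsImproper : ∀ {n} {G : Graph n} → ℕ → EdgeColoring G → Set
IsImproper {G = G} k α =
  ∀ u c → count (λ v → adj G u v ∧ (col α u v ≡ᵇ c)) ≤ k

IsInterval : ∀ {n} {G : Graph n} → EdgeColoring G → Set
IsInterval {G = G} α =
  ∀ u v w c → adj G u v ≡ true → adj G u w ≡ true →
  col α u v ≤ c → c ≤ col α u w →
  ∃[ x ] (adj G u x ≡ true × col α u x ≡ c)

HasImproperInterval : ∀ {n} → Graph n → ℕ → Set
HasImproperInterval G k =
  Σ (EdgeColoring G) λ α → IsImproper k α × IsInterval α

-- μ_int(G) ≤ m  (μ_int is the least k with a k-improper interval colouring)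
μint≤ : ∀ {n} → Graph n → ℕ → Set
μint≤ G m = ∃[ k ] (k ≤ m × HasImproperInterval G k)

-- Let k = ⌈Δ/2⌉ ≥ 3.  Every multigraph has a balanced orientation (|d⁺ − d⁻| ≤ 1 at every
-- vertex): split a path a – b – c off into an edge a c, orient the smaller multigraph, and route
-- the edge a c back through b.  A balanced orientation of the bipartite double cover of G, read
-- as a red/blue colouring of E(G), makes red and blue degrees differ by at most 2, so both colour
-- classes have maximum degree ≤ k + 1; orient each class in a balanced way as well.
-- Red edges get colour 1 and blue edges colour 2, except that every vertex of degree k + 1 in a
-- class picks one of its out-arcs in that class, which brings the main colours down to ≤ k.
-- A picked edge gets colour 0 or 3, decided at the endpoint that did not pick it so as to sit
-- next to a main colour occurring there.  The edges of colour 0 or 3 at u are the one u picked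
-- and picked in-arcs of u, and in a balanced class of degree ≤ k + 1 the in-degree is < k; a
-- short case analysis on which main colours occur at u bounds them by k and shows that the
-- colours at u always form an interval.

module Submission where

open import Defs hiding (sym)
open import Data.Nat using (ℕ; zero; suc; _+_; _*_; _∸_; _≤_; _<_; z≤n; s≤s; _≤?_; _≡ᵇ_; ⌈_/2⌉)
open import Data.Nat.Properties
  using ( ≤-refl; ≤-trans; ≤-reflexive; ≤-antisym; ≤-pred; n≤1+n; n<1+n; m≤m+n; m≤n+m; m≤m⊔n; m≤n⊔m
        ; +-suc; +-assoc; +-comm; +-identityʳ; *-comm; *-identityˡ; *-identityʳ
        ; +-mono-≤; +-monoˡ-≤; +-monoʳ-≤; +-mono-<; +-monoʳ-<; +-cancelʳ-≡; +-cancelʳ-≤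
        ; 1+n≰n; <⇒≱; ≤⇒≯; ≰⇒>; ≤∧≢⇒<; n<1⇒n≡0; n≤0⇒n≡0; m∸n+n≡m; m+n≡0⇒m≡0; m+n≡0⇒n≡0
        ; ≡ᵇ⇒≡; ≡⇒≡ᵇ; ⌈n/2⌉-mono; ⌊n/2⌋+⌈n/2⌉≡n; ⌊n/2⌋≤⌈n/2⌉
        ; +-commutativeSemigroup; +-*-semiring; module ≤-Reasoning )
open import Data.Nat.Tactic.RingSolver using (solve-∀)
open import Data.Bool using (Bool; true; false; if_then_else_; _∧_; _∨_; not)
open import Data.Bool.Properties
  using (∧-conicalˡ; ∧-conicalʳ; ∨-conicalˡ; ∨-conicalʳ; ∧-identityʳ; ∧-zeroʳ; ∨-zeroʳ; ¬-not; not-¬; T-≡)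
  renaming (_≟_ to _≟ᵇ_)
open import Data.Fin using (Fin; zero; suc; _↑ˡ_; _↑ʳ_; splitAt)
open import Data.Fin.Properties using (_≟_; _<?_; <-cmp; any?; suc-injective; splitAt-↑ˡ; splitAt-↑ʳ)
open import Data.Product using (∃-syntax; _×_; _,_; proj₁; proj₂; map₂)
open import Data.Sum using (_⊎_; inj₁; inj₂)
open import Data.Empty using (⊥; ⊥-elim)
open import Function using (_∘_)
open import Function.Bundles using (Equivalence)
open import Level using (0ℓ)
open import Relation.Nullary using (Dec; yes; no; does; contradiction)
open import Relation.Nullary.Decidable using (_×-dec_; ¬?; dec-true; dec-false)
open import Relation.Binary.Bundles using (Setoid)
open import Relation.Binary.Definitions using (tri<; tri≈; tri>)
open import Relation.Binary.PropositionalEquality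
  using (_≡_; _≢_; refl; sym; trans; cong; cong₂; subst; subst₂; module ≡-Reasoning)
import Relation.Binary.Reasoning.Setoid
open import Algebra.Properties.CommutativeSemigroup +-commutativeSemigroup using (interchange; xy∙z≈xz∙y)
open import Algebra.Properties.Semiring.Sum +-*-semiring
  using (sum; sum-cong-≗; ∑-distrib-+; *-distribˡ-sum; *-distribʳ-sum; sum-replicate-zero)

module Counting where

  count-cong : ∀ {m} {P Q : Fin m → Bool} → (∀ i → P i ≡ Q i) → count P ≡ count Q
  count-cong {zero}  P≡Q = refl
  count-cong {suc m} P≡Q rewrite P≡Q zero = cong (_ +_) (count-cong (P≡Q ∘ suc))

  count-zero : ∀ {m} {P : Fin m → Bool} → (∀ i → P i ≡ false) → count P ≡ 0
  count-zero {zero}  P≡f = refl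
  count-zero {suc m} P≡f rewrite P≡f zero = count-zero (P≡f ∘ suc)

  count-mono : ∀ {m} {P Q : Fin m → Bool} → (∀ i → P i ≡ true → Q i ≡ true) → count P ≤ count Q
  count-mono {zero} P⇒Q = z≤n
  count-mono {suc m} {P} {Q} P⇒Q with P zero in P0 | Q zero in Q0
  ... | true  | true  = s≤s (count-mono (P⇒Q ∘ suc))
  ... | true  | false = contradiction (trans (sym (P⇒Q zero P0)) Q0) λ ()
  ... | false | true  = ≤-trans (count-mono (P⇒Q ∘ suc)) (n≤1+n _)
  ... | false | false = count-mono (P⇒Q ∘ suc)

  count-strict : ∀ {m} {P Q : Fin m → Bool} → (∀ i → P i ≡ true → Q i ≡ true) →
                 ∀ w → Q w ≡ true → P w ≡ false → suc (count P) ≤ count Q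
  count-strict {suc m} {P} {Q} P⇒Q zero Qw Pw rewrite Qw | Pw = s≤s (count-mono (P⇒Q ∘ suc))
  count-strict {suc m} {P} {Q} P⇒Q (suc w) Qw Pw with P zero in P0 | Q zero in Q0
  ... | true  | true  = s≤s (count-strict (P⇒Q ∘ suc) w Qw Pw)
  ... | true  | false = contradiction (trans (sym (P⇒Q zero P0)) Q0) λ ()
  ... | false | true  = ≤-trans (count-strict (P⇒Q ∘ suc) w Qw Pw) (n≤1+n _)
  ... | false | false = count-strict (P⇒Q ∘ suc) w Qw Pw

  count-split : ∀ {m} (P Q : Fin m → Bool) → count P ≡ count (λ i → P i ∧ Q i) + count (λ i → P i ∧ not (Q i))
  count-split {zero}  P Q = refl
  count-split {suc m} P Q with P zero | Q zero
  ... | true  | true  = cong suc (count-split (P ∘ suc) (Q ∘ suc))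
  ... | true  | false = trans (cong suc (count-split (P ∘ suc) (Q ∘ suc))) (sym (+-suc _ _))
  ... | false | _     = count-split (P ∘ suc) (Q ∘ suc)

  count-∨ : ∀ {m} {P Q R : Fin m → Bool} → (∀ i → P i ≡ true → Q i ≡ true ⊎ R i ≡ true) →
            count P ≤ count Q + count R
  count-∨ {P = P} {Q} {R} P⇒Q∨R = ≤-trans (≤-reflexive (count-split P Q))
    (+-mono-≤ (count-mono λ i PQ → ∧-conicalʳ (P i) _ PQ) (count-mono only-R))
    where
    only-R : ∀ i → (P i ∧ not (Q i)) ≡ true → R i ≡ true
    only-R i P¬Q with P⇒Q∨R i (∧-conicalˡ (P i) _ P¬Q)
    ... | inj₁ Qi = contradiction (trans (sym (cong not Qi)) (∧-conicalʳ (P i) _ P¬Q)) λ ()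
    ... | inj₂ Ri = Ri

  ∨-true : ∀ {a b} → a ∨ b ≡ true → a ≡ true ⊎ b ≡ true
  ∨-true {true}  _  = inj₁ refl
  ∨-true {false} b≡ = inj₂ b≡

  not≡true : ∀ {b} → not b ≡ true → b ≡ false
  not≡true {false} _ = refl

  count-++ : ∀ {m n} (P : Fin (m + n) → Bool) → count P ≡ count (λ i → P (i ↑ˡ n)) + count (λ j → P (m ↑ʳ j))
  count-++ {zero}      P = refl
  count-++ {suc m} {n} P =
    trans (cong (first +_) (count-++ {m} (P ∘ suc))) (sym (+-assoc first _ _))
    where first = if P zero then 1 else 0

  count-≤1 : ∀ {m} {P : Fin m → Bool} → (∀ i j → P i ≡ true → P j ≡ true → i ≡ j) → count P ≤ 1
  count-≤1 {zero} unique = z≤n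
  count-≤1 {suc m} {P} unique with P zero in P0
  ... | true  = s≤s (≤-reflexive (count-zero λ i → ¬-not λ Pi → 0≢suc (unique zero (suc i) P0 Pi)))
    where 0≢suc : ∀ {i : Fin m} → zero ≢ suc i
          0≢suc ()
  ... | false = count-≤1 λ i j Pi Pj → suc-injective (unique (suc i) (suc j) Pi Pj)

  count-witness : ∀ {m} {P : Fin m → Bool} → 1 ≤ count P → ∃[ i ] P i ≡ true
  count-witness {m} {P} 1≤ with any? (λ i → P i ≟ᵇ true)
  ... | yes found = found
  ... | no ∄ = contradiction (≤-trans 1≤ (≤-reflexive (count-zero λ i → ¬-not λ Pi → ∄ (i , Pi)))) λ ()

  count-witness-≢ : ∀ {m} {P : Fin m → Bool} → 2 ≤ count P → ∀ z → ∃[ i ] P i ≡ true × i ≢ z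
  count-witness-≢ {m} {P} 2≤ z with any? (λ i → (P i ≟ᵇ true) ×-dec ¬? (i ≟ z))
  ... | yes found = found
  ... | no ∄ = contradiction (≤-trans 2≤ (count-≤1 only-z)) (1+n≰n {1})
    where
    only-z : ∀ i j → P i ≡ true → P j ≡ true → i ≡ j
    only-z i j Pi Pj with i ≟ z | j ≟ z
    ... | yes refl | yes refl = refl
    ... | no i≢z | _ = contradiction (i , Pi , i≢z) ∄
    ... | _ | no j≢z = contradiction (j , Pj , j≢z) ∄

  exists : ∀ {m} → (Fin m → Bool) → Bool
  exists P = does (any? λ i → P i ≟ᵇ true)

  exists-intro : ∀ {m} {P : Fin m → Bool} i → P i ≡ true → exists P ≡ true
  exists-intro i Pi = dec-true (any? _) (i , Pi)

  exists-elim : ∀ {m} {P : Fin m → Bool} → exists P ≡ true → ∃[ i ] P i ≡ true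
  exists-elim {P = P} ∃P with any? (λ i → P i ≟ᵇ true)
  ... | yes found = found

  canonical : ∀ {m} → (Fin m → Bool) → Fin m → Bool
  canonical P i with any? (λ j → P j ≟ᵇ true)
  ... | yes (j , _) = does (i ≟ j)
  ... | no _        = false

  canonical-sound : ∀ {m} {P : Fin m → Bool} i → canonical P i ≡ true → P i ≡ true
  canonical-sound {P = P} i can with any? (λ j → P j ≟ᵇ true)
  ... | yes (j , Pj) with i ≟ j
  ...   | yes refl = Pj

  canonical-unique : ∀ {m} {P : Fin m → Bool} i i′ → canonical P i ≡ true → canonical P i′ ≡ true → i ≡ i′
  canonical-unique {P = P} i i′ can can′ with any? (λ j → P j ≟ᵇ true)
  ... | yes (j , _) with i ≟ j | i′ ≟ j
  ...   | yes refl | yes refl = refl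

  canonical-exists : ∀ {m} {P : Fin m → Bool} i → P i ≡ true → ∃[ j ] canonical P j ≡ true
  canonical-exists {P = P} i Pi with any? (λ j → P j ≟ᵇ true)
  ... | yes (j , _) = j , dec-true (j ≟ j) refl
  ... | no ∄ = contradiction (i , Pi) ∄

open Counting

module Arithmetic where

  ≡ᵇ-true : ∀ {a c} → (a ≡ᵇ c) ≡ true → a ≡ c
  ≡ᵇ-true {a} {c} eq = ≡ᵇ⇒≡ a c (Equivalence.from T-≡ eq)

  ≡⇒≡ᵇ-true : ∀ {a c} → a ≡ c → (a ≡ᵇ c) ≡ true
  ≡⇒≡ᵇ-true {a} {c} eq = Equivalence.to T-≡ (≡⇒≡ᵇ a c eq)

  half-≤ : ∀ {a c} → a + a ≤ c + c → a ≤ c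
  half-≤ {a} {c} a+a≤c+c with a ≤? c
  ... | yes a≤c = a≤c
  ... | no a≰c = contradiction a+a≤c+c (<⇒≱ (+-mono-< (≰⇒> a≰c) (≰⇒> a≰c)))

  -- Below, o and i are the out- and in-degree of a vertex in a balanced orientation.

  2≤out : ∀ {o i k} → 3 ≤ k → i ≤ o + 1 → o + i ≡ suc k → 2 ≤ o
  2≤out {o} {i} {k} 3≤k i≤o+1 o+i≡1+k with 2 ≤? o
  ... | yes 2≤o = 2≤o
  ... | no 2≰o = contradiction (s≤s 3≤k) (≤⇒≯ (begin
        suc k      ≡⟨ o+i≡1+k ⟨
        o + i      ≤⟨ +-mono-≤ o≤1 (≤-trans i≤o+1 (+-monoˡ-≤ 1 o≤1)) ⟩
        3          ∎))
    where
    open ≤-Reasoning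
    o≤1 = ≤-pred (≰⇒> 2≰o)

  1≤out : ∀ {o i} → i ≤ o + 1 → 2 ≤ o + i → 1 ≤ o
  1≤out {zero}  i≤1 2≤i = contradiction (≤-trans 2≤i i≤1) λ { (s≤s ()) }
  1≤out {suc o} _   _   = s≤s z≤n

  in<k : ∀ {o i k} → 3 ≤ k → i ≤ o + 1 → o + i ≤ suc k → suc i ≤ k
  in<k {o} {i} {k} 3≤k i≤o+1 o+i≤1+k with suc i ≤? k
  ... | yes 1+i≤k = 1+i≤k
  ... | no 1+i≰k = contradiction i+i≤k+2 (<⇒≱ (begin-strict
        k + 2      <⟨ +-monoʳ-< k 3≤k ⟩
        k + k      ≤⟨ +-mono-≤ k≤i k≤i ⟩
        i + i      ∎))
    where
    open ≤-Reasoning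
    k≤i = ≤-pred (≰⇒> 1+i≰k)
    o+1+i≡1+o+i : ∀ o i → o + 1 + i ≡ suc (o + i)
    o+1+i≡1+o+i = solve-∀
    i+i≤k+2 : i + i ≤ k + 2
    i+i≤k+2 = begin
      i + i        ≤⟨ +-monoˡ-≤ i i≤o+1 ⟩
      o + 1 + i    ≡⟨ o+1+i≡1+o+i o i ⟩
      suc (o + i)  ≤⟨ s≤s o+i≤1+k ⟩
      2 + k        ≡⟨ +-comm 2 k ⟩
      k + 2        ∎

open Arithmetic

module Multidigraphs where

  sum-zero : ∀ {m} {f : Fin m → ℕ} → (∀ i → f i ≡ 0) → sum f ≡ 0
  sum-zero {m} f≡0 = trans (sum-cong-≗ f≡0) (sum-replicate-zero m)

  Digraph : ℕ → Set
  Digraph m = Fin m → Fin m → ℕ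

  point : ∀ {m} → Fin m → Fin m → ℕ
  point a x = if does (x ≟ a) then 1 else 0

  sum-point : ∀ {m} (a : Fin m) → sum (point a) ≡ 1
  sum-point {suc m} zero = cong suc (sum-zero {m} λ _ → refl)
  sum-point {suc m} (suc a) = sum-point a

  module _ {m : ℕ} where

    arc : Fin m → Fin m → Digraph m
    arc a b u v = point a u * point b v

    infixl 6 _⊕_
    _⊕_ : Digraph m → Digraph m → Digraph m
    (O ⊕ P) u v = O u v + P u v

    outdeg indeg : Digraph m → Fin m → ℕ
    outdeg O x = sum (O x)
    indeg  O x = sum (λ u → O u x)

    size : Digraph m → ℕ
    size O = sum (outdeg O)

    infix 4 _≐_ _≅_
    _≐_ : Digraph m → Digraph m → Set
    O ≐ P = ∀ u v → O u v ≡ P u v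

    record _≅_ (O P : Digraph m) : Set where
      constructor same-edges
      field edges-≡ : ∀ u v → O u v + O v u ≡ P u v + P v u
    open _≅_

    Balanced : Digraph m → Set
    Balanced O = ∀ x → outdeg O x ≤ indeg O x + 1 × indeg O x ≤ outdeg O x + 1

    Isolated : Digraph m → Fin m → Set
    Isolated O x = ∀ y → O x y + O y x ≡ 0

    point-self : ∀ (a : Fin m) → point a a ≡ 1
    point-self a with a ≟ a
    ... | yes _ = refl
    ... | no a≢a = contradiction refl a≢a

    point-other : ∀ {a x : Fin m} → x ≢ a → point a x ≡ 0
    point-other {a} {x} x≢a with x ≟ a
    ... | yes x≡a = contradiction x≡a x≢a
    ... | no _ = refl

    point≤1 : ∀ (a x : Fin m) → point a x ≤ 1
    point≤1 a x with x ≟ a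
    ... | yes _ = s≤s z≤n
    ... | no _ = z≤n

    outdeg-⊕ : ∀ O P x → outdeg (O ⊕ P) x ≡ outdeg O x + outdeg P x
    outdeg-⊕ O P x = ∑-distrib-+ (O x) (P x)

    indeg-⊕ : ∀ O P x → indeg (O ⊕ P) x ≡ indeg O x + indeg P x
    indeg-⊕ O P x = ∑-distrib-+ (λ u → O u x) (λ u → P u x)

    outdeg-arc : ∀ a b x → outdeg (arc a b) x ≡ point a x
    outdeg-arc a b x = begin
      sum (λ v → point a x * point b v) ≡⟨ *-distribˡ-sum (point a x) (point b) ⟨
      point a x * sum (point b)         ≡⟨ cong (point a x *_) (sum-point b) ⟩
      point a x * 1                     ≡⟨ *-identityʳ (point a x) ⟩
      point a x                         ∎
      where open ≡-Reasoning

    indeg-arc : ∀ a b x → indeg (arc a b) x ≡ point b x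
    indeg-arc a b x = begin
      sum (λ u → point a u * point b x) ≡⟨ *-distribʳ-sum (point b x) (point a) ⟨
      sum (point a) * point b x         ≡⟨ cong (_* point b x) (sum-point a) ⟩
      1 * point b x                     ≡⟨ *-identityˡ (point b x) ⟩
      point b x                         ∎
      where open ≡-Reasoning

    size-⊕ : ∀ O P → size (O ⊕ P) ≡ size O + size P
    size-⊕ O P = trans (sum-cong-≗ (outdeg-⊕ O P)) (∑-distrib-+ (outdeg O) (outdeg P))

    size-arc : ∀ a b → size (arc a b) ≡ 1
    size-arc a b = trans (sum-cong-≗ (outdeg-arc a b)) (sum-point a)

    outdeg-≐ : ∀ {O P} → O ≐ P → ∀ x → outdeg O x ≡ outdeg P x
    outdeg-≐ O≐P x = sum-cong-≗ (O≐P x)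

    indeg-≐ : ∀ {O P} → O ≐ P → ∀ x → indeg O x ≡ indeg P x
    indeg-≐ O≐P x = sum-cong-≗ (λ u → O≐P u x)

    size-≐ : ∀ {O P} → O ≐ P → size O ≡ size P
    size-≐ O≐P = sum-cong-≗ (outdeg-≐ O≐P)

    ≐⇒≅ : ∀ {O P} → O ≐ P → O ≅ P
    ≐⇒≅ O≐P = same-edges λ u v → cong₂ _+_ (O≐P u v) (O≐P v u)

    ≅-setoid : Setoid 0ℓ 0ℓ
    ≅-setoid = record
      { Carrier = Digraph m
      ; _≈_ = _≅_
      ; isEquivalence = record
        { refl = same-edges λ u v → refl
        ; sym = λ O≅P → same-edges λ u v → sym (edges-≡ O≅P u v)
        ; trans = λ O≅P P≅Q → same-edges λ u v → trans (edges-≡ O≅P u v) (edges-≡ P≅Q u v)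
        }
      }

    open Setoid ≅-setoid public using () renaming (refl to ≅-refl; sym to ≅-sym; trans to ≅-trans)

    module ≅-Reasoning = Relation.Binary.Reasoning.Setoid ≅-setoid

    ⊕-cong : ∀ {O O′ P P′} → O ≅ O′ → P ≅ P′ → O ⊕ P ≅ O′ ⊕ P′
    ⊕-cong {O} {O′} {P} {P′} O≅O′ P≅P′ = same-edges λ u v → begin
      (O u v + P u v) + (O v u + P v u)     ≡⟨ interchange (O u v) (P u v) _ _ ⟩
      (O u v + O v u) + (P u v + P v u)     ≡⟨ cong₂ _+_ (edges-≡ O≅O′ u v) (edges-≡ P≅P′ u v) ⟩
      (O′ u v + O′ v u) + (P′ u v + P′ v u) ≡⟨ interchange (O′ u v) (O′ v u) _ _ ⟩
      (O′ u v + P′ u v) + (O′ v u + P′ v u) ∎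
      where open ≡-Reasoning

    infixl 6 _⊕≅_
    _⊕≅_ : ∀ {O O′} → O ≅ O′ → ∀ P → O ⊕ P ≅ O′ ⊕ P
    O≅O′ ⊕≅ P = ⊕-cong O≅O′ (≅-refl {P})

    ⊕-cancelʳ : ∀ {O O′} P → O ⊕ P ≅ O′ ⊕ P → O ≅ O′
    ⊕-cancelʳ {O} {O′} P O⊕P≅O′⊕P = same-edges λ u v → +-cancelʳ-≡ (P u v + P v u) _ _ (begin
      (O u v + O v u) + (P u v + P v u)   ≡⟨ interchange (O u v) (O v u) _ _ ⟩
      (O u v + P u v) + (O v u + P v u)   ≡⟨ edges-≡ O⊕P≅O′⊕P u v ⟩
      (O′ u v + P u v) + (O′ v u + P v u) ≡⟨ interchange (O′ u v) (P u v) _ _ ⟩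
      (O′ u v + O′ v u) + (P u v + P v u) ∎)
      where open ≡-Reasoning

    ⊕-swap : ∀ O P Q → O ⊕ P ⊕ Q ≅ O ⊕ Q ⊕ P
    ⊕-swap O P Q = ≐⇒≅ λ u v → xy∙z≈xz∙y (O u v) (P u v) (Q u v)

    arc-flip : ∀ a b → arc a b ≅ arc b a
    arc-flip a b = same-edges λ u v → trans (+-comm (arc a b u v) _) (cong₂ _+_ (*-comm (point a v) _) (*-comm (point a u) _))

    arc≤ : ∀ {O : Digraph m} {a b} → 1 ≤ O a b → ∀ u v → arc a b u v ≤ O u v
    arc≤ {O} {a} {b} 1≤Oab u v with u ≟ a | v ≟ b
    ... | yes refl | yes refl = 1≤Oab
    ... | yes _    | no _     = z≤n
    ... | no _     | _        = z≤n

    remove-arc : ∀ {O : Digraph m} {a b} → 1 ≤ O a b → ∃[ O₁ ] O ≐ O₁ ⊕ arc a b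
    remove-arc {O} {a} {b} 1≤Oab = (λ u v → O u v ∸ arc a b u v) , λ u v → sym (m∸n+n≡m (arc≤ {O} 1≤Oab u v))

    size-⊕arc : ∀ O a b → size (O ⊕ arc a b) ≡ suc (size O)
    size-⊕arc O a b = begin
      size (O ⊕ arc a b)      ≡⟨ size-⊕ O (arc a b) ⟩
      size O + size (arc a b) ≡⟨ cong (size O +_) (size-arc a b) ⟩
      size O + 1              ≡⟨ +-comm (size O) 1 ⟩
      suc (size O)            ∎
      where open ≡-Reasoning

    size-remove-arc : ∀ {O O₁ a b} → O ≐ O₁ ⊕ arc a b → size O ≡ suc (size O₁)
    size-remove-arc {O} {O₁} {a} {b} O≐ = trans (size-≐ O≐) (size-⊕arc O₁ a b)

    remove-edge : ∀ {O : Digraph m} {x y} → 1 ≤ O x y + O y x → ∃[ O₁ ] (O ≐ O₁ ⊕ arc x y ⊎ O ≐ O₁ ⊕ arc y x)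
    remove-edge {O} {x} {y} 1≤ with 1 ≤? O x y
    ... | yes 1≤Oxy = map₂ inj₁ (remove-arc {O} 1≤Oxy)
    ... | no 1≰Oxy  = map₂ inj₂ (remove-arc {O} (subst (1 ≤_) (cong (_+ O y x) (n<1⇒n≡0 (≰⇒> 1≰Oxy))) 1≤))

    balanced-≐ : ∀ {O P} → O ≐ P → Balanced O → Balanced P
    balanced-≐ O≐P bal x =
      subst₂ (λ o i → o ≤ i + 1 × i ≤ o + 1) (outdeg-≐ O≐P x) (indeg-≐ O≐P x) (bal x)

    balanced-zero : ∀ {O} → (∀ u v → O u v ≡ 0) → Balanced O
    balanced-zero O≡0 x rewrite sum-zero (O≡0 x) | sum-zero (λ u → O≡0 u x) = z≤n , z≤n

    balanced-shift : ∀ {O P} (f : Fin m → ℕ) →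
                     (∀ x → outdeg P x ≡ outdeg O x + f x) → (∀ x → indeg P x ≡ indeg O x + f x) →
                     Balanced O → Balanced P
    balanced-shift {O} f out≡ in≡ bal x rewrite out≡ x | in≡ x =
      shift (proj₁ (bal x)) , shift (proj₂ (bal x))
      where
      shift : ∀ {p q} → p ≤ q + 1 → p + f x ≤ q + f x + 1
      shift {p} {q} p≤ = subst (p + f x ≤_) (xy∙z≈xz∙y q 1 (f x)) (+-monoˡ-≤ (f x) p≤)

    balanced-subdivide : ∀ {R} p b q → Balanced (R ⊕ arc p q) → Balanced (R ⊕ arc p b ⊕ arc b q)
    balanced-subdivide {R} p b q = balanced-shift (point b) out≡ in≡
      where
      open ≡-Reasoning
      out≡ : ∀ x → outdeg (R ⊕ arc p b ⊕ arc b q) x ≡ outdeg (R ⊕ arc p q) x + point b x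
      out≡ x = begin
        outdeg (R ⊕ arc p b ⊕ arc b q) x                       ≡⟨ outdeg-⊕ (R ⊕ arc p b) (arc b q) x ⟩
        outdeg (R ⊕ arc p b) x + outdeg (arc b q) x            ≡⟨ cong₂ _+_ (outdeg-⊕ R (arc p b) x) (outdeg-arc b q x) ⟩
        outdeg R x + outdeg (arc p b) x + point b x            ≡⟨ cong (λ d → outdeg R x + d + point b x) (outdeg-arc p b x) ⟩
        outdeg R x + point p x + point b x                     ≡⟨ cong (λ d → outdeg R x + d + point b x) (outdeg-arc p q x) ⟨
        outdeg R x + outdeg (arc p q) x + point b x            ≡⟨ cong (_+ point b x) (outdeg-⊕ R (arc p q) x) ⟨
        outdeg (R ⊕ arc p q) x + point b x                     ∎
      in≡ : ∀ x → indeg (R ⊕ arc p b ⊕ arc b q) x ≡ indeg (R ⊕ arc p q) x + point b x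
      in≡ x = begin
        indeg (R ⊕ arc p b ⊕ arc b q) x                        ≡⟨ indeg-⊕ (R ⊕ arc p b) (arc b q) x ⟩
        indeg (R ⊕ arc p b) x + indeg (arc b q) x              ≡⟨ cong₂ _+_ (indeg-⊕ R (arc p b) x) (indeg-arc b q x) ⟩
        indeg R x + indeg (arc p b) x + point q x              ≡⟨ cong (λ d → indeg R x + d + point q x) (indeg-arc p b x) ⟩
        indeg R x + point b x + point q x                      ≡⟨ xy∙z≈xz∙y (indeg R x) (point b x) (point q x) ⟩
        indeg R x + point q x + point b x                      ≡⟨ cong (λ d → indeg R x + d + point b x) (indeg-arc p q x) ⟨
        indeg R x + indeg (arc p q) x + point b x              ≡⟨ cong (_+ point b x) (indeg-⊕ R (arc p q) x) ⟨
        indeg (R ⊕ arc p q) x + point b x                      ∎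

    isolated-outdeg : ∀ {O : Digraph m} {x} → Isolated O x → outdeg O x ≡ 0
    isolated-outdeg {O} {x} iso = sum-zero λ y → m+n≡0⇒m≡0 (O x y) (iso y)

    isolated-indeg : ∀ {O : Digraph m} {x} → Isolated O x → indeg O x ≡ 0
    isolated-indeg {O} {x} iso = sum-zero λ y → m+n≡0⇒n≡0 (O x y) (iso y)

    balanced-isolated : ∀ {R a b} → Balanced R → Isolated R a → Isolated R b → Balanced (R ⊕ arc a b)
    balanced-isolated {R} {a} {b} bal iso-a iso-b x =
      subst₂ (λ o i → o ≤ i + 1 × i ≤ o + 1)
        (sym (trans (outdeg-⊕ R (arc a b) x) (cong (outdeg R x +_) (outdeg-arc a b x))))
        (sym (trans (indeg-⊕ R (arc a b) x) (cong (indeg R x +_) (indeg-arc a b x))))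
        (local (x ≟ a) (x ≟ b))
      where
      at-isolated : Isolated R x →
        outdeg R x + point a x ≤ indeg R x + point b x + 1 × indeg R x + point b x ≤ outdeg R x + point a x + 1
      at-isolated iso rewrite isolated-outdeg {R} iso | isolated-indeg {R} iso =
        ≤-trans (point≤1 a x) (m≤n+m 1 _) , ≤-trans (point≤1 b x) (m≤n+m 1 _)
      local : Dec (x ≡ a) → Dec (x ≡ b) →
        outdeg R x + point a x ≤ indeg R x + point b x + 1 × indeg R x + point b x ≤ outdeg R x + point a x + 1
      local (yes refl) _        = at-isolated iso-a
      local (no _)    (yes refl) = at-isolated iso-b
      local (no x≢a)  (no x≢b)
        rewrite point-other x≢a | point-other x≢b | +-identityʳ (outdeg R x) | +-identityʳ (indeg R x) = bal x

    BalancedReorientation : Digraph m → Set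
    BalancedReorientation O = ∃[ R ] R ≅ O × Balanced R

    balancedReorientation-≅ : ∀ {O P} → O ≅ P → BalancedReorientation P → BalancedReorientation O
    balancedReorientation-≅ O≅P (R , R≅P , bal) = R , ≅-trans R≅P (≅-sym O≅P) , bal

    isolated-≅ : ∀ {O P : Digraph m} {x} → O ≅ P → Isolated P x → Isolated O x
    isolated-≅ {x = x} O≅P iso y = trans (edges-≡ O≅P x y) (iso y)

    isolated-or-touched : ∀ O x → Isolated O x ⊎ ∃[ y ] 1 ≤ O x y + O y x
    isolated-or-touched O x with any? (λ y → 1 ≤? O x y + O y x)
    ... | yes touched = inj₂ touched
    ... | no ¬touched = inj₁ λ y → n<1⇒n≡0 (≰⇒> λ 1≤ → ¬touched (y , 1≤))

    remove-edge≅ : ∀ {O : Digraph m} {x y} → 1 ≤ O x y + O y x →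
                   ∃[ O₁ ] O ≅ O₁ ⊕ arc x y × size O ≡ suc (size O₁)
    remove-edge≅ {O} {x} {y} 1≤ with remove-edge {O} 1≤
    ... | O₁ , inj₁ O≐ = O₁ , ≐⇒≅ O≐ , size-remove-arc O≐
    ... | O₁ , inj₂ O≐ = O₁ , ≅-trans (≐⇒≅ O≐) (⊕-cong (≅-refl {O₁}) (arc-flip y x)) , size-remove-arc O≐

    arc-self : ∀ (a b : Fin m) → arc a b a b ≡ 1
    arc-self a b = cong₂ _*_ (point-self a) (point-self b)

    edge-⊕arc : ∀ O (a b : Fin m) → 1 ≤ (O ⊕ arc a b) a b + (O ⊕ arc a b) b a
    edge-⊕arc O a b = ≤-trans (≤-trans (≤-reflexive (sym (arc-self a b))) (m≤n+m _ (O a b))) (m≤m+n _ _)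

    -- Orient O₁ − bc + ac instead, then replace the arc between a and c by a path through b.
    split-off : ∀ {O₁ : Digraph m} {a b c} → 1 ≤ O₁ b c + O₁ c b →
                (∀ P → size P ≤ size O₁ → BalancedReorientation P) → BalancedReorientation (O₁ ⊕ arc a b)
    split-off {O₁} {a} {b} {c} 1≤bc reorient with remove-edge≅ {O₁} 1≤bc
    ... | O₂ , O₁≅ , size≡ with reorient (O₂ ⊕ arc a c) (≤-reflexive same-size)
      where
      same-size : size (O₂ ⊕ arc a c) ≡ size O₁
      same-size = trans (size-⊕arc O₂ a c) (sym size≡)
    ... | R , R≅ , balR with remove-edge {R} (subst (1 ≤_) (sym (edges-≡ R≅ a c)) (edge-⊕arc O₂ a c))
    ...   | R′ , inj₁ R≐ = R′ ⊕ arc a b ⊕ arc b c , reoriented , balanced-subdivide a b c (balanced-≐ R≐ balR)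
      where
      open ≅-Reasoning
      R′≅O₂ : R′ ≅ O₂
      R′≅O₂ = ⊕-cancelʳ (arc a c) (≅-trans (≅-sym (≐⇒≅ R≐)) R≅)
      reoriented : R′ ⊕ arc a b ⊕ arc b c ≅ O₁ ⊕ arc a b
      reoriented = begin
        R′ ⊕ arc a b ⊕ arc b c   ≈⟨ R′≅O₂ ⊕≅ arc a b ⊕≅ arc b c ⟩
        O₂ ⊕ arc a b ⊕ arc b c   ≈⟨ ⊕-swap O₂ (arc a b) (arc b c) ⟩
        O₂ ⊕ arc b c ⊕ arc a b   ≈⟨ ≅-sym O₁≅ ⊕≅ arc a b ⟩
        O₁ ⊕ arc a b             ∎
    ...   | R′ , inj₂ R≐ = R′ ⊕ arc c b ⊕ arc b a , reoriented , balanced-subdivide c b a (balanced-≐ R≐ balR)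
      where
      open ≅-Reasoning
      R′≅O₂ : R′ ≅ O₂
      R′≅O₂ = ⊕-cancelʳ (arc a c) (begin
        R′ ⊕ arc a c   ≈⟨ ⊕-cong (≅-refl {R′}) (arc-flip a c) ⟩
        R′ ⊕ arc c a   ≈⟨ ≐⇒≅ R≐ ⟨
        R              ≈⟨ R≅ ⟩
        O₂ ⊕ arc a c   ∎)
      reoriented : R′ ⊕ arc c b ⊕ arc b a ≅ O₁ ⊕ arc a b
      reoriented = begin
        R′ ⊕ arc c b ⊕ arc b a   ≈⟨ ⊕-cong (⊕-cong R′≅O₂ (arc-flip c b)) (arc-flip b a) ⟩
        O₂ ⊕ arc b c ⊕ arc a b   ≈⟨ ≅-sym O₁≅ ⊕≅ arc a b ⟩
        O₁ ⊕ arc a b             ∎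

    add-arc : ∀ {O₁ : Digraph m} a b →
              (∀ P → size P ≤ size O₁ → BalancedReorientation P) → BalancedReorientation (O₁ ⊕ arc a b)
    add-arc {O₁} a b reorient with isolated-or-touched O₁ b | isolated-or-touched O₁ a
    ... | inj₂ (c , 1≤bc) | _ = split-off 1≤bc reorient
    ... | inj₁ _ | inj₂ (c , 1≤ac) =
      balancedReorientation-≅ (⊕-cong (≅-refl {O₁}) (arc-flip a b)) (split-off 1≤ac reorient)
    ... | inj₁ iso-b | inj₁ iso-a with reorient O₁ ≤-refl
    ...   | R , R≅O₁ , balR =
      R ⊕ arc a b , R≅O₁ ⊕≅ arc a b , balanced-isolated balR (isolated-≅ R≅O₁ iso-a) (isolated-≅ R≅O₁ iso-b)

    reorient : ∀ n O → size O < n → BalancedReorientation O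
    reorient (suc n) O (s≤s size≤n) with any? (λ a → any? (λ b → 1 ≤? O a b))
    ... | no ∄arc = O , ≅-refl , balanced-zero λ u v → n<1⇒n≡0 (≰⇒> λ 1≤ → ∄arc (u , v , 1≤))
    ... | yes (a , b , 1≤ab) with remove-arc {O} 1≤ab
    ...   | O₁ , O≐ = balancedReorientation-≅ (≐⇒≅ O≐) (add-arc a b λ P P≤ →
                        reorient n P (≤-trans (s≤s P≤) (subst (_≤ n) (size-remove-arc O≐) size≤n)))

    balanced-reorientation : ∀ O → BalancedReorientation O
    balanced-reorientation O = reorient (suc (size O)) O ≤-refl

open Multidigraphs

module Orientations where

  count≡sum : ∀ {m} (P : Fin m → Bool) → count P ≡ sum (λ i → if P i then 1 else 0)
  count≡sum {zero}  P = refl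
  count≡sum {suc m} P = cong ((if P zero then 1 else 0) +_) (count≡sum (λ i → P (suc i)))

  module _ {m : ℕ} (E : Fin m → Fin m → Bool) where

    outArcs inArcs : (Fin m → Fin m → Bool) → Fin m → ℕ
    outArcs dir x = count (λ y → E x y ∧ dir x y)
    inArcs  dir x = count (λ y → E x y ∧ not (dir x y))

    record BalancedOrientation : Set where
      field
        dir      : Fin m → Fin m → Bool
        dir-flip : ∀ u v → E u v ≡ true → dir u v ≡ not (dir v u)
        out≤in+1 : ∀ x → outArcs dir x ≤ inArcs dir x + 1
        in≤out+1 : ∀ x → inArcs dir x ≤ outArcs dir x + 1

  module _ {m : ℕ} {E : Fin m → Fin m → Bool}
           (E-sym : ∀ u v → E u v ≡ E v u) (E-irrefl : ∀ u → E u u ≡ false) where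

    private
      ⟦_⟧ : Bool → ℕ
      ⟦ b ⟧ = if b then 1 else 0

      upward : Digraph m
      upward u v = ⟦ E u v ∧ does (u <? v) ⟧

      upward-edges : ∀ u v → upward u v + upward v u ≡ ⟦ E u v ⟧
      upward-edges u v with <-cmp u v
      ... | tri< u<v _ v≮u rewrite dec-true (u <? v) u<v | dec-false (v <? u) v≮u
                                  | ∧-identityʳ (E u v) | ∧-zeroʳ (E v u) = +-identityʳ _
      ... | tri≈ _ refl _ rewrite E-irrefl u = refl
      ... | tri> u≮v _ v<u rewrite dec-false (u <? v) u≮v | dec-true (v <? u) v<u
                                  | ∧-zeroʳ (E u v) | ∧-identityʳ (E v u) | E-sym v u = refl

      split-edge : ∀ p q b → p + q ≡ ⟦ b ⟧ → ⟦ b ∧ (p ≡ᵇ 1) ⟧ ≡ p × ⟦ b ∧ not (p ≡ᵇ 1) ⟧ ≡ q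
      split-edge zero          zero          false _  = refl , refl
      split-edge zero          (suc zero)    true  _  = refl , refl
      split-edge (suc zero)    zero          true  _  = refl , refl
      split-edge zero          (suc (suc _)) true  ()
      split-edge (suc zero)    (suc _)       true  ()
      split-edge (suc (suc _)) _             true  ()
      split-edge zero          (suc _)       false ()
      split-edge (suc _)       _             false ()

      one-direction : ∀ p q → p + q ≡ 1 → (p ≡ᵇ 1) ≡ not (q ≡ᵇ 1)
      one-direction zero          (suc zero) _ = refl
      one-direction (suc zero)    zero       _ = refl
      one-direction zero          (suc (suc _)) ()
      one-direction (suc zero)    (suc _)    ()
      one-direction (suc (suc _)) _          ()

      from-reorientation : BalancedReorientation upward → BalancedOrientation E
      from-reorientation (R , R≅upward , balR) = record
        { dir      = dir
        ; dir-flip = λ u v Euv → one-direction (R u v) (R v u) (trans (edges u v) (cong ⟦_⟧ Euv))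
        ; out≤in+1 = λ x → subst₂ (λ o i → o ≤ i + 1) (sym (out≡ x)) (sym (in≡ x)) (proj₁ (balR x))
        ; in≤out+1 = λ x → subst₂ (λ i o → i ≤ o + 1) (sym (in≡ x)) (sym (out≡ x)) (proj₂ (balR x))
        }
        where
        edges : ∀ u v → R u v + R v u ≡ ⟦ E u v ⟧
        edges u v = trans (_≅_.edges-≡ R≅upward u v) (upward-edges u v)
        dir : Fin m → Fin m → Bool
        dir u v = R u v ≡ᵇ 1
        out≡ : ∀ x → outArcs E dir x ≡ outdeg R x
        out≡ x = trans (count≡sum (λ y → E x y ∧ dir x y))
                       (sum-cong-≗ λ y → proj₁ (split-edge (R x y) (R y x) (E x y) (edges x y)))
        in≡ : ∀ x → inArcs E dir x ≡ indeg R x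
        in≡ x = trans (count≡sum (λ y → E x y ∧ not (dir x y)))
                      (sum-cong-≗ λ y → proj₂ (split-edge (R x y) (R y x) (E x y) (edges x y)))

    opaque
      balanced-orientation : BalancedOrientation E
      balanced-orientation = from-reorientation (balanced-reorientation upward)

open Orientations

module EquitableColourings where

  colourIs : Bool → Bool → Bool
  colourIs true  c = c
  colourIs false c = not c

  colourIs-unique : ∀ b b′ c → colourIs b c ≡ true → colourIs b′ c ≡ true → b ≡ b′
  colourIs-unique true  true  _     _  _  = refl
  colourIs-unique false false _     _  _  = refl
  colourIs-unique true  false true  _  ()
  colourIs-unique true  false false () _
  colourIs-unique false true  true  () _
  colourIs-unique false true  false _  ()

  colourIs-self : ∀ c → colourIs c c ≡ true
  colourIs-self true  = refl
  colourIs-self false = refl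

  colourIs-not : ∀ b c → colourIs b (not c) ≡ colourIs (not b) c
  colourIs-not true  c = refl
  colourIs-not false true = refl
  colourIs-not false false = refl

  module _ {n : ℕ} (adj : Fin n → Fin n → Bool) where

    InClass : (Fin n → Fin n → Bool) → Bool → Fin n → Fin n → Bool
    InClass colour b x y = adj x y ∧ colourIs b (colour x y)

    record EquitableColouring : Set where
      field
        colour     : Fin n → Fin n → Bool
        colour-sym : ∀ x y → colour x y ≡ colour y x
        equitable  : ∀ b x → count (InClass colour b x) ≤ count (InClass colour (not b) x) + 2

  module _ {n : ℕ} {adj : Fin n → Fin n → Bool}
           (adj-sym : ∀ u v → adj u v ≡ adj v u) (adj-irrefl : ∀ u → adj u u ≡ false) where

    private
      _⁺ _⁻ : Fin n → Fin (n + n)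
      x ⁺ = x ↑ˡ n
      x ⁻ = n ↑ʳ x

      -- Bipartite double cover: x ⁺ carries the edges from x to larger neighbours, x ⁻ those to
      -- smaller ones; an edge is red when its cover edge is oriented from the ⁺ side.
      cover-sides : Fin n ⊎ Fin n → Fin n ⊎ Fin n → Bool
      cover-sides (inj₁ x) (inj₂ y) = adj x y ∧ does (x <? y)
      cover-sides (inj₂ y) (inj₁ x) = adj x y ∧ does (x <? y)
      cover-sides _        _        = false

      cover : Fin (n + n) → Fin (n + n) → Bool
      cover p q = cover-sides (splitAt n p) (splitAt n q)

      cover-sym : ∀ p q → cover p q ≡ cover q p
      cover-sym p q with splitAt n p | splitAt n q
      ... | inj₁ _ | inj₁ _ = refl
      ... | inj₁ _ | inj₂ _ = refl
      ... | inj₂ _ | inj₁ _ = refl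
      ... | inj₂ _ | inj₂ _ = refl

      cover-irrefl : ∀ p → cover p p ≡ false
      cover-irrefl p with splitAt n p
      ... | inj₁ _ = refl
      ... | inj₂ _ = refl

      cover-⁺⁻ : ∀ x y → cover (x ⁺) (y ⁻) ≡ adj x y ∧ does (x <? y)
      cover-⁺⁻ x y rewrite splitAt-↑ˡ n x n | splitAt-↑ʳ n n y = refl

      cover-⁻⁺ : ∀ x y → cover (x ⁻) (y ⁺) ≡ adj y x ∧ does (y <? x)
      cover-⁻⁺ x y rewrite splitAt-↑ʳ n n x | splitAt-↑ˡ n y n = refl

      cover-⁺⁺ : ∀ x y → cover (x ⁺) (y ⁺) ≡ false
      cover-⁺⁺ x y rewrite splitAt-↑ˡ n x n | splitAt-↑ˡ n y n = refl

      cover-⁻⁻ : ∀ x y → cover (x ⁻) (y ⁻) ≡ false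
      cover-⁻⁻ x y rewrite splitAt-↑ʳ n n x | splitAt-↑ʳ n n y = refl

      open BalancedOrientation (balanced-orientation cover-sym cover-irrefl)

      colour : Fin n → Fin n → Bool
      colour x y = if does (x <? y) then dir (x ⁺) (y ⁻) else dir (y ⁺) (x ⁻)

      colour-sym : ∀ x y → colour x y ≡ colour y x
      colour-sym x y with <-cmp x y
      ... | tri< x<y _ y≮x rewrite dec-true (x <? y) x<y | dec-false (y <? x) y≮x = refl
      ... | tri≈ _ refl _ = refl
      ... | tri> x≮y _ y<x rewrite dec-false (x <? y) x≮y | dec-true (y <? x) y<x = refl

      upward-in-cover : ∀ b x y →
        (InClass adj colour b x y ∧ does (x <? y)) ≡ (cover (x ⁺) (y ⁻) ∧ colourIs b (dir (x ⁺) (y ⁻)))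
      upward-in-cover b x y rewrite cover-⁺⁻ x y with <-cmp x y
      ... | tri< x<y _ _ rewrite dec-true (x <? y) x<y | ∧-identityʳ (adj x y) = ∧-identityʳ _
      ... | tri≈ x≮y _ _ rewrite dec-false (x <? y) x≮y | ∧-zeroʳ (adj x y) = ∧-zeroʳ _
      ... | tri> x≮y _ _ rewrite dec-false (x <? y) x≮y | ∧-zeroʳ (adj x y) = ∧-zeroʳ _

      downward-in-cover : ∀ b x y →
        (InClass adj colour b x y ∧ not (does (x <? y))) ≡ (cover (x ⁻) (y ⁺) ∧ colourIs (not b) (dir (x ⁻) (y ⁺)))
      downward-in-cover b x y rewrite cover-⁻⁺ x y with <-cmp x y
      ... | tri< x<y _ y≮x rewrite dec-true (x <? y) x<y | dec-false (y <? x) y≮x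
                                 | ∧-zeroʳ (adj y x) = ∧-zeroʳ _
      ... | tri≈ _ refl _ rewrite adj-irrefl x = refl
      ... | tri> x≮y _ y<x rewrite dec-false (x <? y) x≮y | dec-true (y <? x) y<x
                                 | ∧-identityʳ (adj y x) | adj-sym y x with adj x y in adj-xy
      ...   | false = refl
      ...   | true  = trans (∧-identityʳ _) (trans (cong (colourIs b) flipped) (colourIs-not b _))
        where
        flipped : dir (y ⁺) (x ⁻) ≡ not (dir (x ⁻) (y ⁺))
        flipped = dir-flip (y ⁺) (x ⁻) (trans (cover-⁺⁻ y x) (cong₂ _∧_ (trans (adj-sym y x) adj-xy) (dec-true (y <? x) y<x)))

      arcs : Bool → Fin (n + n) → ℕ
      arcs b p = count (λ q → cover p q ∧ colourIs b (dir p q))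

      arcs-balanced : ∀ b p → arcs b p ≤ arcs (not b) p + 1
      arcs-balanced true  p = out≤in+1 p
      arcs-balanced false p = in≤out+1 p

      restrict-⁺ : ∀ x (F : Fin (n + n) → Bool) →
                   count (λ q → cover (x ⁺) q ∧ F q) ≡ count (λ y → cover (x ⁺) (y ⁻) ∧ F (y ⁻))
      restrict-⁺ x F = trans (count-++ {n} (λ q → cover (x ⁺) q ∧ F q))
        (cong (_+ count (λ y → cover (x ⁺) (y ⁻) ∧ F (y ⁻))) (count-zero λ y → cong (_∧ F (y ⁺)) (cover-⁺⁺ x y)))

      restrict-⁻ : ∀ x (F : Fin (n + n) → Bool) →
                   count (λ q → cover (x ⁻) q ∧ F q) ≡ count (λ y → cover (x ⁻) (y ⁺) ∧ F (y ⁺))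
      restrict-⁻ x F = trans (count-++ {n} (λ q → cover (x ⁻) q ∧ F q))
        (trans (cong (count (λ y → cover (x ⁻) (y ⁺) ∧ F (y ⁺)) +_) (count-zero λ y → cong (_∧ F (y ⁻)) (cover-⁻⁻ x y)))
               (+-identityʳ _))

      class-count : ∀ b x → count (InClass adj colour b x) ≡ arcs b (x ⁺) + arcs (not b) (x ⁻)
      class-count b x = trans (count-split (InClass adj colour b x) (λ y → does (x <? y)))
        (cong₂ _+_ (trans (count-cong (upward-in-cover b x)) (sym (restrict-⁺ x λ q → colourIs b (dir (x ⁺) q))))
                   (trans (count-cong (downward-in-cover b x)) (sym (restrict-⁻ x λ q → colourIs (not b) (dir (x ⁻) q)))))

    opaque
      equitable-colouring : EquitableColouring adj
      equitable-colouring = record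
        { colour     = colour
        ; colour-sym = colour-sym
        ; equitable  = λ b x → begin
            count (InClass adj colour b x)                               ≡⟨ class-count b x ⟩
            arcs b (x ⁺) + arcs (not b) (x ⁻)                            ≤⟨ +-mono-≤ (arcs-balanced b (x ⁺)) (arcs-balanced (not b) (x ⁻)) ⟩
            (arcs (not b) (x ⁺) + 1) + (arcs (not (not b)) (x ⁻) + 1)   ≡⟨ regroup (arcs (not b) (x ⁺)) _ ⟩
            (arcs (not b) (x ⁺) + arcs (not (not b)) (x ⁻)) + 2          ≡⟨ cong (_+ 2) (class-count (not b) x) ⟨
            count (InClass adj colour (not b) x) + 2                     ∎
        }
        where
        open ≤-Reasoning
        regroup : ∀ p q → (p + 1) + (q + 1) ≡ (p + q) + 2
        regroup = solve-∀

open EquitableColourings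

module ImproperIntervalColouring {n : ℕ} (G : Graph n) (k : ℕ) (3≤k : 3 ≤ k) (degree≤ : ∀ x → degree G x ≤ k + k) where

  open EquitableColouring (equitable-colouring (Graph.sym G) (irrefl G))

  class : Bool → Fin n → Fin n → Bool
  class = InClass (adj G) colour

  class-sym : ∀ b u v → class b u v ≡ class b v u
  class-sym b u v = cong₂ (λ e c → e ∧ colourIs b c) (Graph.sym G u v) (colour-sym u v)

  class-irrefl : ∀ b u → class b u u ≡ false
  class-irrefl b u rewrite irrefl G u = refl

  private
    orientation : ∀ b → BalancedOrientation (class b)
    orientation b = balanced-orientation (class-sym b) (class-irrefl b)

  dir : Bool → Fin n → Fin n → Bool
  dir b = BalancedOrientation.dir (orientation b)

  d d⁺ d⁻ : Bool → Fin n → ℕ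
  d  b x = count (class b x)
  d⁺ b x = outArcs (class b) (dir b) x
  d⁻ b x = inArcs (class b) (dir b) x

  d⁻≤d⁺+1 : ∀ b x → d⁻ b x ≤ d⁺ b x + 1
  d⁻≤d⁺+1 b = BalancedOrientation.in≤out+1 (orientation b)

  dir-flip : ∀ b u v → class b u v ≡ true → dir b u v ≡ not (dir b v u)
  dir-flip b = BalancedOrientation.dir-flip (orientation b)

  d⁺+d⁻ : ∀ b x → d⁺ b x + d⁻ b x ≡ d b x
  d⁺+d⁻ b x = sym (count-split (class b x) (dir b x))

  degree-split : ∀ x → degree G x ≡ d true x + d false x
  degree-split x = count-split (adj G x) (colour x)

  d≤1+k : ∀ b x → d b x ≤ suc k
  d≤1+k b x = half-≤ (begin
    d b x + d b x                ≤⟨ +-monoʳ-≤ (d b x) (equitable b x) ⟩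
    d b x + (d (not b) x + 2)    ≡⟨ +-assoc (d b x) (d (not b) x) 2 ⟨
    d b x + d (not b) x + 2      ≤⟨ +-monoˡ-≤ 2 (≤-trans (≤-reflexive (sym (both-classes b))) (degree≤ x)) ⟩
    k + k + 2                    ≡⟨ m+m+2 k ⟩
    suc k + suc k                ∎)
    where
    open ≤-Reasoning
    both-classes : ∀ b → degree G x ≡ d b x + d (not b) x
    both-classes true  = degree-split x
    both-classes false = trans (degree-split x) (+-comm (d true x) (d false x))
    m+m+2 : ∀ m → m + m + 2 ≡ suc m + suc m
    m+m+2 = solve-∀

  critical : Bool → Fin n → Bool
  critical b x = d b x ≡ᵇ suc k

  critical-d : ∀ b x → critical b x ≡ true → d b x ≡ suc k
  critical-d b x crit = ≡ᵇ-true crit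

  noncritical-d : ∀ b x → critical b x ≡ false → d b x ≤ k
  noncritical-d b x ¬crit =
    ≤-pred (≤∧≢⇒< (d≤1+k b x) λ d≡1+k → contradiction (trans (sym (≡⇒≡ᵇ-true d≡1+k)) ¬crit) λ ())

  isCritical : Fin n → Bool
  isCritical x = critical true x ∨ critical false x

  critical⇒isCritical : ∀ b {x} → critical b x ≡ true → isCritical x ≡ true
  critical⇒isCritical true  {x} crit = cong (_∨ critical false x) crit
  critical⇒isCritical false {x} crit = trans (cong (critical true x ∨_) crit) (∨-zeroʳ (critical true x))

  -- the class in which x is critical, if x is critical at all
  criticalClass : Fin n → Bool
  criticalClass x = critical true x

  not-critical-twice : ∀ x → critical true x ≡ true → critical false x ≡ true → ⊥
  not-critical-twice x crit-t crit-f = <⇒≱ (begin-strict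
    k + k                 <⟨ +-mono-< (n<1+n k) (n<1+n k) ⟩
    suc k + suc k         ≡⟨ cong₂ _+_ (critical-d true x crit-t) (critical-d false x crit-f) ⟨
    d true x + d false x  ≡⟨ degree-split x ⟨
    degree G x            ∎) (degree≤ x)
    where open ≤-Reasoning

  criticalClass-critical : ∀ x → isCritical x ≡ true → critical (criticalClass x) x ≡ true
  criticalClass-critical x crit with critical true x in crit-t
  ... | true  = crit-t
  ... | false = crit

  criticalClass-unique : ∀ b x → critical b x ≡ true → criticalClass x ≡ b
  criticalClass-unique true  x crit = crit
  criticalClass-unique false x crit with critical true x in crit-t
  ... | true  = ⊥-elim (not-critical-twice x crit-t crit)
  ... | false = refl

  outArc : Bool → Fin n → Fin n → Bool
  outArc b x y = class b x y ∧ dir b x y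

  2≤d⁺-critical : ∀ x → isCritical x ≡ true → 2 ≤ d⁺ (criticalClass x) x
  2≤d⁺-critical x crit =
    2≤out 3≤k (d⁻≤d⁺+1 (criticalClass x) x)
      (trans (d⁺+d⁻ (criticalClass x) x) (critical-d (criticalClass x) x (criticalClass-critical x crit)))

  picks : Fin n → Fin n → Bool
  picks x y = isCritical x ∧ canonical (outArc (criticalClass x) x) y

  picks-critical : ∀ x y → picks x y ≡ true → isCritical x ≡ true
  picks-critical x y = ∧-conicalˡ (isCritical x) _

  picks-outArc : ∀ x y → picks x y ≡ true → outArc (criticalClass x) x y ≡ true
  picks-outArc x y p = canonical-sound y (∧-conicalʳ (isCritical x) _ p)

  picks-unique : ∀ x y y′ → picks x y ≡ true → picks x y′ ≡ true → y ≡ y′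
  picks-unique x y y′ p p′ = canonical-unique y y′ (∧-conicalʳ (isCritical x) _ p) (∧-conicalʳ (isCritical x) _ p′)

  picks-noncritical : ∀ x y → isCritical x ≡ false → picks x y ≡ false
  picks-noncritical x y ¬crit rewrite ¬crit = refl

  picks-exists : ∀ x → isCritical x ≡ true → ∃[ y ] picks x y ≡ true
  picks-exists x crit with count-witness {P = outArc (criticalClass x) x} (≤-trans (s≤s z≤n) (2≤d⁺-critical x crit))
  ... | y , out-xy with canonical-exists {P = outArc (criticalClass x) x} y out-xy
  ...   | y′ , can = y′ , trans (cong (_∧ canonical (outArc (criticalClass x) x) y′) crit) can

  class-unique : ∀ b b′ u v → class b u v ≡ true → class b′ v u ≡ true → b ≡ b′
  class-unique b b′ u v uv vu =
    colourIs-unique b b′ (colour u v) (∧-conicalʳ (adj G u v) _ uv)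
      (trans (cong (colourIs b′) (colour-sym u v)) (∧-conicalʳ (adj G v u) _ vu))

  outArc-not-picked-back : ∀ b u y → outArc b u y ≡ true → picks y u ≡ false
  outArc-not-picked-back b u y out-uy with picks y u in picked
  ... | false = refl
  ... | true  = contradiction (trans (sym dir-uy) (trans (dir-flip b u y class-uy) (cong not dir-yu))) λ ()
    where
    class-uy = ∧-conicalˡ (class b u y) _ out-uy
    dir-uy = ∧-conicalʳ (class b u y) _ out-uy
    out-yu = picks-outArc y u picked
    dir-yu : dir b y u ≡ true
    dir-yu = subst (λ c → dir c y u ≡ true) (sym (class-unique b (criticalClass y) u y class-uy (∧-conicalˡ _ _ out-yu)))
                   (∧-conicalʳ (class (criticalClass y) y u) _ out-yu)

  picks-asym : ∀ x y → picks x y ≡ true → picks y x ≡ false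
  picks-asym x y p = outArc-not-picked-back (criticalClass x) x y (picks-outArc x y p)

  picked-inArc : ∀ b u v → picks v u ≡ true → class b u v ≡ true → dir b u v ≡ false
  picked-inArc b u v p class-uv = trans (dir-flip b u v class-uv) (cong not dir-vu)
    where
    out-vu = picks-outArc v u p
    dir-vu : dir b v u ≡ true
    dir-vu = subst (λ c → dir c v u ≡ true) (class-unique (criticalClass v) b v u (∧-conicalˡ _ _ out-vu) class-uv)
                   (∧-conicalʳ (class (criticalClass v) v u) _ out-vu)

  special : Fin n → Fin n → Bool
  special x y = picks x y ∨ picks y x

  -- the main colour of class b occurs at u
  present : Bool → Fin n → Bool
  present b u = exists (λ y → class b u y ∧ not (special u y))

  present-intro : ∀ b u y → outArc b u y ≡ true → picks u y ≡ false → present b u ≡ true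
  present-intro b u y out-uy ¬picks = exists-intro y (begin
    class b u y ∧ not (picks u y ∨ picks y u) ≡⟨ cong₂ (λ c p → c ∧ not p) (∧-conicalˡ (class b u y) _ out-uy)
                                                  (cong₂ _∨_ ¬picks (outArc-not-picked-back b u y out-uy)) ⟩
    true                                      ∎)
    where open ≡-Reasoning

  present-critical-class : ∀ u → isCritical u ≡ true → present (criticalClass u) u ≡ true
  present-critical-class u crit with picks-exists u crit
  ... | p , picks-p with count-witness-≢ {P = outArc (criticalClass u) u} (2≤d⁺-critical u crit) p
  ...   | y , out-uy , y≢p = present-intro _ u y out-uy (¬-not λ picks-y → y≢p (picks-unique u y p picks-y picks-p))

  present-other-class : ∀ u → isCritical u ≡ true → present (not (criticalClass u)) u ≡ true
  present-other-class u crit = present-intro c′ u y out-uy (¬-not λ picks-y → c≢c′ (class-unique c c′ u y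
      (∧-conicalˡ (class c u y) _ (picks-outArc u y picks-y))
      (trans (class-sym c′ y u) (∧-conicalˡ (class c′ u y) _ out-uy))))
    where
    c c′ : Bool
    c  = criticalClass u
    c′ = not c
    c≢c′ : c ≢ c′
    c≢c′ = not-¬ refl
    2≤d : 2 ≤ d c′ u
    2≤d = +-cancelʳ-≤ 2 2 (d c′ u)
            (≤-trans (s≤s 3≤k) (subst (_≤ d c′ u + 2) (critical-d c u (criticalClass-critical u crit)) (equitable c u)))
    found : ∃[ y ] outArc c′ u y ≡ true
    found = count-witness (1≤out (d⁻≤d⁺+1 c′ u) (subst (2 ≤_) (sym (d⁺+d⁻ c′ u)) 2≤d))
    y = proj₁ found
    out-uy = proj₂ found

  present-at-critical : ∀ b u → isCritical u ≡ true → present b u ≡ true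
  present-at-critical b u crit with b ≟ᵇ criticalClass u
  ... | yes refl = present-critical-class u crit
  ... | no b≢c rewrite ¬-not b≢c = present-other-class u crit

  absent⇒noncritical : ∀ b u → present b u ≡ false → isCritical u ≡ false
  absent⇒noncritical b u absent = ¬-not λ crit → not-¬ absent (present-at-critical b u crit)

  absent⇒d⁺≡0 : ∀ b u → present b u ≡ false → d⁺ b u ≡ 0
  absent⇒d⁺≡0 b u absent = count-zero λ y → ¬-not λ out-uy →
    not-¬ absent (present-intro b u y out-uy (picks-noncritical u y (absent⇒noncritical b u absent)))

  absent⇒d⁻≤1 : ∀ b u → present b u ≡ false → d⁻ b u ≤ 1
  absent⇒d⁻≤1 b u absent = subst (λ o → d⁻ b u ≤ o + 1) (absent⇒d⁺≡0 b u absent) (d⁻≤d⁺+1 b u)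

  d⁻<k : ∀ b u → d⁻ b u < k
  d⁻<k b u = in<k 3≤k (d⁻≤d⁺+1 b u) (subst (_≤ suc k) (sym (d⁺+d⁻ b u)) (d≤1+k b u))

  main outer : Bool → ℕ
  main  true  = 1
  main  false = 2
  outer true  = 0
  outer false = 3

  -- colour of a picked edge of class b at its endpoint u that did not pick it
  endColour : Fin n → Bool → ℕ
  endColour u b = if present b u then outer b else if present (not b) u then outer (not b) else 0

  α : Fin n → Fin n → ℕ
  α x y = if picks x y then endColour y (colour x y)
          else if picks y x then endColour x (colour x y)
          else main (colour x y)

  α-sym : ∀ x y → α x y ≡ α y x
  α-sym x y with picks x y in pxy | picks y x in pyx
  ... | true  | true  = contradiction (trans (sym pyx) (picks-asym x y pxy)) λ ()
  ... | true  | false = cong (endColour y) (colour-sym x y)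
  ... | false | true  = cong (endColour x) (colour-sym x y)
  ... | false | false = cong main (colour-sym x y)

  colouring : EdgeColoring G
  colouring = record { col = α ; col-sym = α-sym }

  data View (x y : Fin n) : Set where
    picked-here  : picks x y ≡ true → α x y ≡ endColour y (colour x y) → View x y
    picked-there : picks x y ≡ false → picks y x ≡ true → α x y ≡ endColour x (colour x y) → View x y
    ordinary     : picks x y ≡ false → picks y x ≡ false → α x y ≡ main (colour x y) → View x y

  α-picked-here : ∀ x y → picks x y ≡ true → α x y ≡ endColour y (colour x y)
  α-picked-here x y p rewrite p = refl

  α-picked-there : ∀ x y → picks x y ≡ false → picks y x ≡ true → α x y ≡ endColour x (colour x y)
  α-picked-there x y p q rewrite p | q = refl

  α-ordinary : ∀ x y → picks x y ≡ false → picks y x ≡ false → α x y ≡ main (colour x y)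
  α-ordinary x y p q rewrite p | q = refl

  view : ∀ x y → View x y
  view x y with picks x y in pxy | picks y x in pyx
  ... | true  | _     = picked-here pxy (α-picked-here x y pxy)
  ... | false | true  = picked-there pxy pyx (α-picked-there x y pxy pyx)
  ... | false | false = ordinary pxy pyx (α-ordinary x y pxy pyx)

  outer-0-or-3 : ∀ b → outer b ≡ 0 ⊎ outer b ≡ 3
  outer-0-or-3 true  = inj₁ refl
  outer-0-or-3 false = inj₂ refl

  endColour-outer : ∀ u b → endColour u b ≡ 0 ⊎ endColour u b ≡ 3
  endColour-outer u b with present b u | present (not b) u
  ... | true  | _     = outer-0-or-3 b
  ... | false | true  = outer-0-or-3 (not b)
  ... | false | false = inj₁ refl

  main-1-or-2 : ∀ b → main b ≡ 1 ⊎ main b ≡ 2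
  main-1-or-2 true  = inj₁ refl
  main-1-or-2 false = inj₂ refl

  endColour≢main : ∀ u b′ b → endColour u b′ ≢ main b
  endColour≢main u b′ b eq = distinct (endColour-outer u b′) (main-1-or-2 b) eq
    where
    distinct : ∀ {a c} → a ≡ 0 ⊎ a ≡ 3 → c ≡ 1 ⊎ c ≡ 2 → a ≢ c
    distinct (inj₁ refl) (inj₁ refl) ()
    distinct (inj₁ refl) (inj₂ refl) ()
    distinct (inj₂ refl) (inj₁ refl) ()
    distinct (inj₂ refl) (inj₂ refl) ()

  main-colourIs : ∀ c b → main c ≡ main b → colourIs b c ≡ true
  main-colourIs true  true  _ = refl
  main-colourIs false false _ = refl

  main-coloured⇒ordinary : ∀ b u v → (adj G u v ∧ (α u v ≡ᵇ main b)) ≡ true →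
                           (class b u v ∧ not (special u v)) ≡ true
  main-coloured⇒ordinary b u v coloured with view u v | ≡ᵇ-true {α u v} (∧-conicalʳ (adj G u v) _ coloured)
  ... | picked-here _ α≡     | α≡main = ⊥-elim (endColour≢main v _ b (trans (sym α≡) α≡main))
  ... | picked-there _ _ α≡  | α≡main = ⊥-elim (endColour≢main u _ b (trans (sym α≡) α≡main))
  ... | ordinary ¬p ¬q α≡    | α≡main rewrite ¬p | ¬q =
    trans (∧-identityʳ _)
      (cong₂ _∧_ (∧-conicalˡ (adj G u v) _ coloured) (main-colourIs (colour u v) b (trans (sym α≡) α≡main)))

  ordinary-count : ∀ b u → count (λ v → class b u v ∧ not (special u v)) ≤ k
  ordinary-count b u with critical b u in crit
  ... | false = ≤-trans (count-mono λ v h → ∧-conicalˡ (class b u v) _ h) (noncritical-d b u crit)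
  ... | true  = ≤-pred (subst (suc (count unpicked) ≤_) (critical-d b u crit)
                  (count-strict {P = unpicked} {Q = class b u} (λ v h → ∧-conicalˡ (class b u v) _ h)
                                p class-up picked-not-unpicked))
    where
    unpicked : Fin n → Bool
    unpicked v = class b u v ∧ not (special u v)
    pick = picks-exists u (critical⇒isCritical b crit)
    p = proj₁ pick
    class-up : class b u p ≡ true
    class-up = subst (λ c → class c u p ≡ true) (criticalClass-unique b u crit)
                 (∧-conicalˡ (class (criticalClass u) u p) _ (picks-outArc u p (proj₂ pick)))
    picked-not-unpicked : unpicked p ≡ false
    picked-not-unpicked rewrite proj₂ pick = ∧-zeroʳ (class b u p)

  main-count : ∀ b u → count (λ v → adj G u v ∧ (α u v ≡ᵇ main b)) ≤ k
  main-count b u = ≤-trans (count-mono (main-coloured⇒ordinary b u)) (ordinary-count b u)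

  receives : Bool → ℕ → Fin n → Fin n → Bool
  receives b c u v = (picks v u ∧ class b u v) ∧ (endColour u b ≡ᵇ c)

  outer-coloured⇒special : ∀ c u v → c ≢ 1 → c ≢ 2 → (adj G u v ∧ (α u v ≡ᵇ c)) ≡ true →
                           picks u v ≡ true ⊎ (receives true c u v ∨ receives false c u v) ≡ true
  outer-coloured⇒special c u v c≢1 c≢2 coloured with view u v | ≡ᵇ-true {α u v} (∧-conicalʳ (adj G u v) _ coloured)
  ... | picked-here p _ | _ = inj₁ p
  ... | ordinary _ _ α≡ | α≡c with main-1-or-2 (colour u v)
  ...   | inj₁ main≡1 = ⊥-elim (c≢1 (trans (sym α≡c) (trans α≡ main≡1)))
  ...   | inj₂ main≡2 = ⊥-elim (c≢2 (trans (sym α≡c) (trans α≡ main≡2)))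
  outer-coloured⇒special c u v c≢1 c≢2 coloured | picked-there _ picked α≡ | α≡c =
    inj₂ (by-colour (colour u v) received)
    where
    by-colour : ∀ b → receives b c u v ≡ true → (receives true c u v ∨ receives false c u v) ≡ true
    by-colour true  r = cong (_∨ receives false c u v) r
    by-colour false r = trans (cong (receives true c u v ∨_) r) (∨-zeroʳ _)
    received : receives (colour u v) c u v ≡ true
    received = cong₂ _∧_
      (cong₂ _∧_ picked (trans (cong (adj G u v ∧_) (colourIs-self (colour u v)))
                               (trans (∧-identityʳ _) (∧-conicalˡ (adj G u v) _ coloured))))
      (≡⇒≡ᵇ-true (trans (sym α≡) α≡c))

  received-bound : ∀ b u t → count (λ v → (picks v u ∧ class b u v) ∧ t) ≤ (if t then d⁻ b u else 0)
  received-bound b u false = ≤-reflexive (count-zero λ v → ∧-zeroʳ (picks v u ∧ class b u v))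
  received-bound b u true  = count-mono λ v h →
    let picked-class = trans (sym (∧-identityʳ _)) h
        class-uv = ∧-conicalʳ (picks v u) _ picked-class
    in cong₂ _∧_ class-uv (cong not (picked-inArc b u v (∧-conicalˡ (picks v u) _ picked-class) class-uv))

  outer-count : ∀ c u → c ≢ 1 → c ≢ 2 → count (λ v → adj G u v ∧ (α u v ≡ᵇ c)) ≤
                count (picks u) + ((if endColour u true ≡ᵇ c then d⁻ true u else 0) +
                                   (if endColour u false ≡ᵇ c then d⁻ false u else 0))
  outer-count c u c≢1 c≢2 =
    ≤-trans (count-∨ (λ v → outer-coloured⇒special c u v c≢1 c≢2))
            (+-monoʳ-≤ (count (picks u))
              (≤-trans (count-∨ {P = λ v → receives true c u v ∨ receives false c u v} (λ v → ∨-true))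
                (+-mono-≤ (received-bound true u (endColour u true ≡ᵇ c))
                          (received-bound false u (endColour u false ≡ᵇ c)))))

  picks-count≤1 : ∀ u → count (picks u) ≤ 1
  picks-count≤1 u = count-≤1 (picks-unique u)

  picks-count-absent : ∀ b u → present b u ≡ false → count (picks u) ≡ 0
  picks-count-absent b u absent = count-zero λ v → picks-noncritical u v (absent⇒noncritical b u absent)

  ≤1⇒<k : ∀ {i} → i ≤ 1 → i < k
  ≤1⇒<k i≤1 = ≤-trans (s≤s i≤1) (≤-trans (s≤s (s≤s z≤n)) 3≤k)

  at-most-one+<k : ∀ {p i} → p ≤ 1 → i < k → p + i ≤ k
  at-most-one+<k {p} {i} p≤1 i<k = ≤-trans (+-monoˡ-≤ i p≤1) i<k

  <k+at-most-one : ∀ {i j} → i < k → j ≤ 1 → i + j ≤ k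
  <k+at-most-one {i} {j} i<k j≤1 = ≤-trans (+-monoʳ-≤ i j≤1) (subst (_≤ k) (+-comm 1 i) i<k)

  colour0-count : ∀ u → count (λ v → adj G u v ∧ (α u v ≡ᵇ 0)) ≤ k
  colour0-count u = ≤-trans (outer-count 0 u (λ ()) (λ ())) bound
    where
    bound : count (picks u) + ((if endColour u true ≡ᵇ 0 then d⁻ true u else 0) +
                               (if endColour u false ≡ᵇ 0 then d⁻ false u else 0)) ≤ k
    bound with present true u in red | present false u in blue
    ... | true  | true  = at-most-one+<k (picks-count≤1 u) (subst (_< k) (sym (+-identityʳ _)) (d⁻<k true u))
    ... | true  | false rewrite picks-count-absent false u blue = <k+at-most-one (d⁻<k true u) (absent⇒d⁻≤1 false u blue)
    ... | false | true  = at-most-one+<k (picks-count≤1 u) (≤1⇒<k z≤n)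
    ... | false | false rewrite picks-count-absent false u blue =
      <k+at-most-one (≤1⇒<k (absent⇒d⁻≤1 true u red)) (absent⇒d⁻≤1 false u blue)

  colour3-count : ∀ u → count (λ v → adj G u v ∧ (α u v ≡ᵇ 3)) ≤ k
  colour3-count u = ≤-trans (outer-count 3 u (λ ()) (λ ())) bound
    where
    bound : count (picks u) + ((if endColour u true ≡ᵇ 3 then d⁻ true u else 0) +
                               (if endColour u false ≡ᵇ 3 then d⁻ false u else 0)) ≤ k
    bound with present true u in red | present false u in blue
    ... | true  | true  = at-most-one+<k (picks-count≤1 u) (d⁻<k false u)
    ... | true  | false = at-most-one+<k (picks-count≤1 u) (≤1⇒<k z≤n)
    ... | false | true  rewrite picks-count-absent true u red = at-most-one+<k (absent⇒d⁻≤1 true u red) (d⁻<k false u)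
    ... | false | false = at-most-one+<k (picks-count≤1 u) (≤1⇒<k z≤n)

  endColour≤3 : ∀ u b → endColour u b ≤ 3
  endColour≤3 u b with endColour-outer u b
  ... | inj₁ e = subst (_≤ 3) (sym e) z≤n
  ... | inj₂ e = subst (_≤ 3) (sym e) ≤-refl

  main≤3 : ∀ b → main b ≤ 3
  main≤3 true  = s≤s z≤n
  main≤3 false = s≤s (s≤s z≤n)

  α≤3 : ∀ u v → α u v ≤ 3
  α≤3 u v with view u v
  ... | picked-here _ α≡    = subst (_≤ 3) (sym α≡) (endColour≤3 v (colour u v))
  ... | picked-there _ _ α≡ = subst (_≤ 3) (sym α≡) (endColour≤3 u (colour u v))
  ... | ordinary _ _ α≡     = subst (_≤ 3) (sym α≡) (main≤3 (colour u v))

  colouring-improper : IsImproper k colouring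
  colouring-improper u 0 = colour0-count u
  colouring-improper u 1 = main-count true u
  colouring-improper u 2 = main-count false u
  colouring-improper u 3 = colour3-count u
  colouring-improper u (suc (suc (suc (suc c)))) = ≤-trans (≤-reflexive (count-zero λ v →
    trans (cong (adj G u v ∧_) (¬-not λ α≡ → too-large (subst (_≤ 3) (≡ᵇ-true α≡) (α≤3 u v)))) (∧-zeroʳ (adj G u v)))) z≤n
    where
    too-large : 4 + c ≤ 3 → ⊥
    too-large (s≤s (s≤s (s≤s ())))

  main-present : ∀ b u → present b u ≡ true → ∃[ w ] adj G u w ≡ true × α u w ≡ main b
  main-present b u pres with exists-elim pres
  ... | w , unpicked with view u w
  ...   | picked-here p _    = contradiction (trans (sym p) (∨-conicalˡ _ _ ¬special)) λ ()
    where ¬special = not≡true (∧-conicalʳ (class b u w) _ unpicked)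
  ...   | picked-there _ q _ = contradiction (trans (sym q) (∨-conicalʳ (picks u w) _ ¬special)) λ ()
    where ¬special = not≡true (∧-conicalʳ (class b u w) _ unpicked)
  ...   | ordinary _ _ α≡    = w , ∧-conicalˡ (adj G u w) _ class-uw , trans α≡ (cong main colour≡b)
    where
    class-uw = ∧-conicalˡ (class b u w) _ unpicked
    colour≡b : colour u w ≡ b
    colour≡b = sym (colourIs-unique b (colour u w) (colour u w) (∧-conicalʳ (adj G u w) _ class-uw) (colourIs-self (colour u w)))

  endColour-0 : ∀ u b → endColour u b ≡ 0 → present true u ≡ true ⊎ present false u ≡ false
  endColour-0 u true e with present true u | present false u
  ... | true  | _     = inj₁ refl
  ... | false | false = inj₂ refl
  ... | false | true  = contradiction e λ ()
  endColour-0 u false e with present false u | present true u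
  ... | false | true  = inj₁ refl
  ... | false | false = inj₂ refl
  ... | true  | _     = contradiction e λ ()

  endColour-3 : ∀ u b → endColour u b ≡ 3 → present false u ≡ true
  endColour-3 u true e with present true u | present false u
  ... | _     | true  = refl
  ... | true  | false = contradiction e λ ()
  ... | false | false = contradiction e λ ()
  endColour-3 u false e with present false u | present true u
  ... | true  | _     = refl
  ... | false | true  = contradiction e λ ()
  ... | false | false = contradiction e λ ()

  colour-0-at : ∀ u v → α u v ≡ 0 → present true u ≡ true ⊎ present false u ≡ false
  colour-0-at u v α≡0 with view u v
  ... | picked-here p _     = inj₁ (present-at-critical true u (picks-critical u v p))
  ... | picked-there _ _ α≡ = endColour-0 u (colour u v) (trans (sym α≡) α≡0)
  ... | ordinary _ _ α≡     = contradiction (trans (sym α≡) α≡0) (main≢0 (colour u v))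
    where
    main≢0 : ∀ b → main b ≢ 0
    main≢0 true  ()
    main≢0 false ()

  colour-≥2-at : ∀ u v → adj G u v ≡ true → 2 ≤ α u v → present false u ≡ true
  colour-≥2-at u v adj-uv 2≤α with view u v
  ... | picked-here p _     = present-at-critical false u (picks-critical u v p)
  ... | picked-there _ _ α≡ with endColour-outer u (colour u v)
  ...   | inj₁ e = contradiction (subst (2 ≤_) (trans α≡ e) 2≤α) λ ()
  ...   | inj₂ e = endColour-3 u (colour u v) e
  colour-≥2-at u v adj-uv 2≤α | ordinary ¬p ¬q α≡ with colour u v in col
  ... | true  = contradiction (subst (2 ≤_) α≡ 2≤α) λ { (s≤s ()) }
  ... | false = exists-intro v (begin
    (adj G u v ∧ not (colour u v)) ∧ not (picks u v ∨ picks v u) ≡⟨ cong₂ (λ a c → (a ∧ not c) ∧ not (picks u v ∨ picks v u)) adj-uv col ⟩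
    not (picks u v ∨ picks v u)                                   ≡⟨ cong₂ (λ p q → not (p ∨ q)) ¬p ¬q ⟩
    true                                                          ∎)
    where open ≡-Reasoning

  colouring-interval : IsInterval colouring
  colouring-interval u v w 0 adj-v _ α≤0 _ = v , adj-v , n≤0⇒n≡0 α≤0
  colouring-interval u v w 1 adj-v adj-w α≤1 1≤α with 2 ≤? α u w
  ... | no 2≰α = w , adj-w , ≤-antisym (≤-pred (≰⇒> 2≰α)) 1≤α
  ... | yes 2≤α with α u v in αv
  ...   | 1 = v , adj-v , αv
  ...   | suc (suc _) = contradiction α≤1 λ { (s≤s ()) }
  ...   | 0 with colour-0-at u v αv
  ...     | inj₁ red   = main-present true u red
  ...     | inj₂ ¬blue = contradiction (trans (sym ¬blue) (colour-≥2-at u w adj-w 2≤α)) λ ()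
  colouring-interval u v w 2 _ adj-w _ 2≤α = main-present false u (colour-≥2-at u w adj-w 2≤α)
  colouring-interval u v w 3 _ adj-w _ 3≤α = w , adj-w , ≤-antisym (α≤3 u w) 3≤α
  colouring-interval u v w (suc (suc (suc (suc c)))) _ _ _ 4≤α =
    contradiction (≤-trans 4≤α (α≤3 u w)) λ { (s≤s (s≤s (s≤s ()))) }

≤-maxFin : ∀ {n} (f : Fin n → ℕ) i → f i ≤ maxFin f
≤-maxFin f zero    = m≤m⊔n _ _
≤-maxFin f (suc i) = ≤-trans (≤-maxFin (f ∘ suc) i) (m≤n⊔m _ _)

≤⌈/2⌉+⌈/2⌉ : ∀ m → m ≤ ⌈ m /2⌉ + ⌈ m /2⌉
≤⌈/2⌉+⌈/2⌉ m = ≤-trans (≤-reflexive (sym (⌊n/2⌋+⌈n/2⌉≡n m))) (+-monoˡ-≤ ⌈ m /2⌉ (⌊n/2⌋≤⌈n/2⌉ m))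

theorem25 : ∀ (n : ℕ) (G : Graph n) → 6 ≤ Δ G → μint≤ G ⌈ Δ G /2⌉
theorem25 n G 6≤Δ = k , ≤-refl , colouring , colouring-improper , colouring-interval
  where
  k = ⌈ Δ G /2⌉
  3≤k : 3 ≤ k
  3≤k = ⌈n/2⌉-mono 6≤Δ
  degree≤ : ∀ x → degree G x ≤ k + k
  degree≤ x = ≤-trans (≤-maxFin (degree G) x) (≤⌈/2⌉+⌈/2⌉ (Δ G))
  open ImproperIntervalColouring G k 3≤k degree≤
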